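{- Let $X$ be an $L$-step subshift of finite type. Then for every positive integer $K$ and every word $w\in\mathcal{L}_L(X)$, the graph $G_{X^{[L]}}([w],K)$ is connected.
   Context: A subshift is a closed, shift-invariant subset of $\mathcal{A}^{\mathbb{Z}}$ (shift $\sigma(u)_n=u_{n+1}$). It is an $L$-step subshift of finite type if it is the set of all bi-infinite words over $\mathcal{A}$ having no subword in some finite set $F\subseteq\mathcal{A}^{L+1}$. $\mathcal{L}_n(Z)$ is the set of subwords of length $n$ of words of $Z$; $w_{[i,j]}=w_i\dots w_j$. The $L$-block presentation $X^{[L]}$ replaces each word $u$ by the word whose $i$-th letter is the block $[u_{[i,i+L-1]}]$. For a word set $Z$, a letter $a$ and $K\ge1$, $G_Z(a,K)$ is the undirected graph whose vertices are the pairs $(i,u)$ with $0\le i<K$, $u\in\mathcal{L}_K(Z)$, $u_i=a$, and whose edges are the pairs $\{(i,w_{[0,K-1]}),(i-1,w_{[1,K]})\}$ with $0<i<K$, $w\in\mathcal{L}_{K+1}(Z)$, $w_i=a$. -}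

module Defs where

open import Data.Nat using (ℕ; suc)
open import Data.Integer using (ℤ; +_; _+_)
open import Data.Fin using (Fin; toℕ; inject₁)
open import Data.Vec using (Vec; tabulate; lookup; init; tail)
open import Data.List using (List)
open import Data.List.Membership.Propositional using (_∈_)
open import Data.Product using (Σ; ∃; _×_; proj₁; proj₂)
open import Relation.Nullary using (¬_)
open import Relation.Binary.PropositionalEquality using (_≡_)
open import Relation.Binary.Construct.Closure.Symmetric using (SymClosure)
open import Relation.Binary.Construct.Closure.ReflexiveTransitive using (Star)

BiWord : Set → Set
BiWord B = ℤ → B

WordSet : Set → Set₁
WordSet B = BiWord B → Set

window : {B : Set} → BiWord B → ℤ → (n : ℕ) → Vec B n
window u i n = tabulate (λ k → u (i + + toℕ k))

SFT : (m L : ℕ) → List (Vec (Fin m) (suc L)) → WordSet (Fin m)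
SFT m L F u = ∀ (i : ℤ) → ¬ (window u i (suc L) ∈ F)

Lang : {B : Set} → WordSet B → (n : ℕ) → Vec B n → Set
Lang Z n v = Σ (BiWord _) λ u → Z u × Σ ℤ λ i → window u i n ≡ v

blockCode : {A : Set} → (L : ℕ) → BiWord A → BiWord (Vec A L)
blockCode L u i = window u i L

BlockPres : {A : Set} → WordSet A → (L : ℕ) → WordSet (Vec A L)
BlockPres X L v = Σ (BiWord _) λ u → X u × (∀ i → v i ≡ blockCode L u i)

Vertex : {B : Set} → WordSet B → B → ℕ → Set
Vertex Z a K = Σ (Fin K) λ i → Σ (Vec _ K) λ u → Lang Z K u × lookup u i ≡ a

vdata : {B : Set} {Z : WordSet B} {a : B} {K : ℕ} → Vertex Z a K → Fin K × Vec B K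
vdata (i Data.Product., u Data.Product., _) = i Data.Product., u

-- (Directed) edge generator of G_Z(a,K): (i, w_[0,K-1]) — (i-1, w_[1,K])
-- for 0 < i < K, w ∈ L_{K+1}(Z), w_i = a.
Edge : {B : Set} → WordSet B → B → (K : ℕ) → Fin K × Vec B K → Fin K × Vec B K → Set
Edge Z a K x y =
  Σ (Vec _ (suc K)) λ w →
    Lang Z (suc K) w × lookup w (inject₁ (proj₁ x)) ≡ a
    × toℕ (proj₁ x) ≡ suc (toℕ (proj₁ y))
    × proj₂ x ≡ init w × proj₂ y ≡ tail w

Connected : {B : Set} → WordSet B → B → ℕ → Set
Connected Z a K =
  Vertex Z a K ×
  (∀ (v v' : Vertex Z a K) → Star (SymClosure (Edge Z a K)) (vdata v) (vdata v'))

-- Every vertex (i, u) of the graph lies on a path (i, u) — (i-1, ·) — … — (0, ·)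
-- obtained by sliding the length-K window of a word of the subshift one step
-- at a time, so it suffices to join two vertices of the form (0, u) and
-- (0, u').  Both start with the block [w]; since X is an L-step subshift of
-- finite type, the past of one word can be spliced onto the future of the
-- other along the shared L-block w, and sliding back and forth along the
-- spliced word joins (0, u) to (0, u').
module Submission where

open import Defs
open import Data.Nat using (ℕ; suc; _≥_)
open import Data.Fin using (Fin)
open import Data.Vec using (Vec)
open import Data.List using (List)

open import Data.Nat using (zero; s≤s; z≤n)
import Data.Nat.Properties as ℕ
open import Data.Integer as ℤ using (ℤ; +_; -[1+_]; -_; _+_; +<+; +≤+; -<+)
import Data.Integer.Properties as ℤ
open import Data.Fin using (zero; suc; toℕ; inject₁; fromℕ; fromℕ<)
import Data.Fin.Properties as Fin
open import Data.Vec using (_∷_; tabulate; lookup; init; tail)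
open import Data.Vec.Properties using (tabulate-cong; lookup∘tabulate)
open import Data.List.Membership.Propositional using (_∈_)
open import Data.Product using (Σ; _×_; _,_)
open import Function using (_∘_)
open import Relation.Binary.PropositionalEquality
open import Relation.Binary.Construct.Closure.Symmetric using (SymClosure; fwd; symmetric)
open import Relation.Binary.Construct.Closure.ReflexiveTransitive using (Star; ε; _◅_; _◅◅_; reverse)

shift : {A : Set} → ℤ → BiWord A → BiWord A
shift q u t = u (q + t)

splice : {A : Set} → BiWord A → BiWord A → BiWord A
splice x x' (+ n)    = x' (+ n)
splice x x' -[1+ n ] = x -[1+ n ]

lookup-window : ∀ {A : Set} (u : BiWord A) p {n} (k : Fin n) → lookup (window u p n) k ≡ u (p + + toℕ k)
lookup-window u p = lookup∘tabulate (λ k → u (p + + toℕ k))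

window-shift : ∀ {A : Set} q (u : BiWord A) p n → window (shift q u) p n ≡ window u (q + p) n
window-shift q u p n = tabulate-cong λ k → cong u (sym (ℤ.+-assoc q p (+ toℕ k)))

init-tabulate : ∀ {A : Set} {n} (f : Fin (suc n) → A) → init (tabulate f) ≡ tabulate (f ∘ inject₁)
init-tabulate {n = zero}  f = refl
init-tabulate {n = suc n} f = cong (f zero ∷_) (init-tabulate (f ∘ suc))

init-window : ∀ {A : Set} (u : BiWord A) p n → init (window u p (suc n)) ≡ window u p n
init-window u p n = trans (init-tabulate (λ k → u (p + + toℕ k))) (tabulate-cong λ k → cong (λ j → u (p + + j)) (Fin.toℕ-inject₁ k))

tail-window : ∀ {A : Set} (u : BiWord A) p n → tail (window u p (suc n)) ≡ window u (p + + 1) n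
tail-window u p n = tabulate-cong λ k → cong u (sym (ℤ.+-assoc p (+ 1) (+ toℕ k)))

module Graph {B : Set} (Z : WordSet B) (a : B) where

  Path : (K : ℕ) → Fin K × Vec B K → Fin K × Vec B K → Set
  Path K = Star (SymClosure (Edge Z a K))

  slide-edge : ∀ {K u p} {i j : Fin K} → Z u → toℕ i ≡ suc (toℕ j) → u (p + + toℕ i) ≡ a →
               Edge Z a K (i , window u p K) (j , window u (p + + 1) K)
  slide-edge {K} {u} {p} {i} uZ i≡1+j ua =
    window u p (suc K) , (u , uZ , p , refl) ,
    trans (lookup-window u p (inject₁ i)) (trans (cong (λ k → u (p + + k)) (Fin.toℕ-inject₁ i)) ua) ,
    i≡1+j , sym (init-window u p K) , sym (tail-window u p K)

  -- n is toℕ i, kept as a separate argument so that the recursion is structural.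
  slide-path : ∀ {K' u p q} → Z u → ∀ n (i : Fin (suc K')) → toℕ i ≡ n → p + + n ≡ q → u q ≡ a →
               Path (suc K') (i , window u p (suc K')) (zero , window u q (suc K'))
  slide-path {K'} {u} {p} uZ zero zero refl p+0≡q ua =
    subst (λ r → Path (suc K') (zero , window u p (suc K')) (zero , window u r (suc K')))
      (trans (sym (ℤ.+-identityʳ p)) p+0≡q) ε
  slide-path {u = u} {p} {q} uZ (suc n) (suc j) i≡1+n p+1+n≡q ua =
    fwd (slide-edge {p = p} uZ (cong suc (sym (Fin.toℕ-inject₁ j))) (trans (cong u p+i≡q) ua)) ◅
    slide-path {p = p + + 1} uZ n (inject₁ j) (trans (Fin.toℕ-inject₁ j) (ℕ.suc-injective i≡1+n))
      (trans (ℤ.+-assoc p (+ 1) (+ n)) p+1+n≡q) ua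
    where
    p+i≡q : p + + toℕ (suc j) ≡ q
    p+i≡q = trans (cong (λ k → p + + k) i≡1+n) p+1+n≡q

  reach-origin : ∀ {K'} (v : Vertex Z a (suc K')) →
                 Σ (BiWord B) λ u → Z u × Σ ℤ λ q → u q ≡ a ×
                   Path (suc K') (vdata v) (zero , window u q (suc K'))
  reach-origin (i , _ , (u , uZ , p , refl) , ui) =
    u , uZ , p + + toℕ i , ua , slide-path {p = p} uZ (toℕ i) i refl refl ua
    where ua = trans (sym (lookup-window u p i)) ui

  origins-connected : ∀ {K' u u' p p' q q'} → Z u → Z u' → window u p (suc K') ≡ window u' p' (suc K') →
                      p + + K' ≡ q → p' + + K' ≡ q' → u q ≡ a → u' q' ≡ a →
                      Path (suc K') (zero , window u q (suc K')) (zero , window u' q' (suc K'))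
  origins-connected {K'} {u' = u'} {p} {p'} {q' = q'} uZ u'Z same p+K'≡q p'+K'≡q' ua u'a =
    reverse (symmetric _) (slide-path {p = p} uZ K' (fromℕ K') (Fin.toℕ-fromℕ K') p+K'≡q ua) ◅◅
    subst (λ v → Path (suc K') (fromℕ K' , v) (zero , window u' q' (suc K'))) (sym same)
      (slide-path {p = p'} u'Z K' (fromℕ K') (Fin.toℕ-fromℕ K') p'+K'≡q' u'a)

splice-agrees : ∀ {A : Set} {L} (x x' : BiWord A) → window x (+ 0) L ≡ window x' (+ 0) L →
                ∀ t → t ℤ.< + L → splice x x' t ≡ x t
splice-agrees x x' same -[1+ n ] _ = refl
splice-agrees x x' same (+ d) (+<+ d<L) = begin
  x' (+ d)                              ≡⟨ cong (λ j → x' (+ j)) (Fin.toℕ-fromℕ< d<L) ⟨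
  x' (+ toℕ k)                          ≡⟨ lookup-window x' (+ 0) k ⟨
  lookup (window x' (+ 0) _) k          ≡⟨ cong (λ v → lookup v k) same ⟨
  lookup (window x (+ 0) _) k           ≡⟨ lookup-window x (+ 0) k ⟩
  x (+ toℕ k)                           ≡⟨ cong (λ j → x (+ j)) (Fin.toℕ-fromℕ< d<L) ⟩
  x (+ d)                               ∎
  where
  open ≡-Reasoning
  k = fromℕ< d<L

blockCode-splice : ∀ {A : Set} {L} (x x' : BiWord A) → window x (+ 0) L ≡ window x' (+ 0) L →
                   ∀ t → t ℤ.≤ + 0 → blockCode L (splice x x') t ≡ blockCode L x t
blockCode-splice x x' same t t≤0 =
  tabulate-cong λ j → splice-agrees x x' same (t + + toℕ j) (ℤ.+-mono-≤-< t≤0 (+<+ (Fin.toℕ<n j)))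

module _ {m L : ℕ} {F : List (Vec (Fin m) (suc L))} where

  SFT-shift : ∀ {x} q → SFT m L F x → SFT m L F (shift q x)
  SFT-shift {x} q xX i = xX (q + i) ∘ subst (_∈ F) (window-shift q x i (suc L))

  -- An (L+1)-window left of 0 meets the right half only inside [0, L), where x and x' agree.
  SFT-splice : ∀ {x x'} → SFT m L F x → SFT m L F x' → window x (+ 0) L ≡ window x' (+ 0) L →
               SFT m L F (splice x x')
  SFT-splice xX x'X same (+ n) = x'X (+ n)
  SFT-splice {x} {x'} xX x'X same -[1+ n ] =
    xX -[1+ n ] ∘ subst (_∈ F) (tabulate-cong λ k →
      splice-agrees x x' same (-[1+ n ] + + toℕ k) (ℤ.+-mono-<-≤ (-<+ {n} {0}) (+≤+ (Fin.toℕ≤pred[n] k))))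

  blockCode-BlockPres : ∀ {x} → SFT m L F x → BlockPres (SFT m L F) L (blockCode L x)
  blockCode-BlockPres {x} xX = x , xX , λ _ → refl

  module _ {w : Vec (Fin m) L} where
    open Graph (BlockPres (SFT m L F) L) w

    reach-block-origin : ∀ {K'} (v : Vertex (BlockPres (SFT m L F) L) w (suc K')) →
                         Σ (BiWord (Fin m)) λ y → SFT m L F y × blockCode L y (+ 0) ≡ w ×
                           Path (suc K') (vdata v) (zero , window (blockCode L y) (+ 0) (suc K'))
    reach-block-origin v with reach-origin v
    ... | u , (x , xX , u≗x) , q , uw , path =
      shift q x , SFT-shift {x} q xX , trans (sym (u≗x q)) uw ,
      subst (λ s → Path _ (vdata v) (zero , s))
        (tabulate-cong λ k → trans (u≗x (q + + toℕ k)) (sym (window-shift q x (+ toℕ k) L))) path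

    block-origins-connected : ∀ {K' y y'} → SFT m L F y → SFT m L F y' →
      blockCode L y (+ 0) ≡ w → blockCode L y' (+ 0) ≡ w →
      Path (suc K') (zero , window (blockCode L y) (+ 0) (suc K'))
                    (zero , window (blockCode L y') (+ 0) (suc K'))
    -- On [0, ∞) the spliced word is y' by computation, so its origin vertex is that of y'.
    block-origins-connected {K'} {y} {y'} yX y'X yw y'w =
      origins-connected {u = blockCode L y} {u' = blockCode L (splice y y')} {p = - + K'} {p' = - + K'}
        (blockCode-BlockPres {y} yX) (blockCode-BlockPres {splice y y'} (SFT-splice {y} {y'} yX y'X agree))
        same-past (ℤ.+-inverseˡ (+ K')) (ℤ.+-inverseˡ (+ K')) yw y'w
      where
      agree : window y (+ 0) L ≡ window y' (+ 0) L
      agree = trans yw (sym y'w)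
      past : (k : Fin (suc K')) → - + K' + + toℕ k ℤ.≤ + 0
      past k = ℤ.≤-trans (ℤ.+-monoʳ-≤ (- + K') (+≤+ (Fin.toℕ≤pred[n] k)))
                         (ℤ.≤-reflexive (ℤ.+-inverseˡ (+ K')))
      same-past : window (blockCode L y) (- + K') (suc K')
                ≡ window (blockCode L (splice y y')) (- + K') (suc K')
      same-past = tabulate-cong λ k → sym (blockCode-splice y y' agree (- + K' + + toℕ k) (past k))

lemma3 : (m L : ℕ) (F : List (Vec (Fin m) (suc L))) (K : ℕ) → K ≥ 1 →
    (w : Vec (Fin m) L) → Lang (SFT m L F) L w →
    Connected (BlockPres (SFT m L F) L) w K
lemma3 m L F (suc K') (s≤s z≤n) w (x , xX , q , xw) = origin , connect
  where
  open Graph (BlockPres (SFT m L F) L) w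

  origin : Vertex (BlockPres (SFT m L F) L) w (suc K')
  origin = zero , window (blockCode L (shift q x)) (+ 0) (suc K') ,
           (_ , blockCode-BlockPres {x = shift q x} (SFT-shift {x = x} q xX) , + 0 , refl) , xw

  connect : ∀ v v' → Path (suc K') (vdata v) (vdata v')
  connect v v' with reach-block-origin v | reach-block-origin v'
  ... | y , yX , yw , path | y' , y'X , y'w , path' =
    path ◅◅ block-origins-connected {y = y} {y'} yX y'X yw y'w ◅◅ reverse (symmetric _) path'
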